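{- Let $L$ be a finite semidistrim lattice and $x\in L$. Then $\mathsf{Row}_L(x)=\bigwedge\kappa_L(\mathcal{D}_L(x))$, $\mathsf{Row}_L^{ -1}(x)=\bigvee\mathcal{U}_L(x)$, $\mathsf{Pop}^\downarrow_L(x)=x\wedge\bigwedge\kappa_L(\mathcal{D}_L(x))$, and $\mathsf{Pop}^\uparrow_L(x)=x\vee\bigvee\mathcal{U}_L(x)$. In particular, $\mathsf{Pop}^\downarrow_L(x)=x\wedge\mathsf{Row}_L(x)$ and $\mathsf{Pop}^\uparrow_L(x)=x\vee\mathsf{Row}_L^{ -1}(x)$.
   Context: All lattices are finite. For a lattice $L$, $\mathcal{J}_L$ (resp. $\mathcal{M}_L$) is the set of join-irreducible (resp. meet-irreducible) elements; for $j\in\mathcal{J}_L$, $j_*$ is the unique element covered by $j$, and for $m\in\mathcal{M}_L$, $m^*$ is the unique element covering $m$. Let $\mathcal{M}_L(j)=\max\{z\in L: j_*=j\wedge z\}$ and $\mathcal{J}_L(m)=\min\{z\in L: m^*=m\vee z\}$. A pairing on $L$ is a bijection $\kappa:\mathcal{J}_L\to\mathcal{M}_L$ with $\kappa(j)\in\mathcal{M}_L(j)$ for all $j$ and $\kappa^{ -1}(m)\in\mathcal{J}_L(m)$ for all $m$; $L$ is uniquely paired if it has exactly one pairing, denoted $\kappa_L$. A prime pair is a pair $(j_0,m_0)$ with $L=[\hat0,m_0]\sqcup[j_0,\hat1]$. A uniquely paired lattice $L$ is compatibly dismantlable if $|L|=1$ or there is a prime pair $(j_0,m_0)$ such that: (i)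 $[j_0,\hat1]$ is compatibly dismantlable and $\alpha(j)=j_0\vee j$ defines a bijection $\{j\in\mathcal{J}_L: j_0\le\kappa_L(j)\}\to\mathcal{J}_{[j_0,\hat1]}$ with $\kappa_{[j_0,\hat1]}(\alpha(j))=\kappa_L(j)$; (ii) $[\hat0,m_0]$ is compatibly dismantlable and $\beta(m)=m_0\wedge m$ defines a bijection $\{m\in\mathcal{M}_L:\kappa_L^{ -1}(m)\le m_0\}\to\mathcal{M}_{[\hat0,m_0]}$ with $\kappa_{[\hat0,m_0]}^{ -1}(\beta(m))=\kappa_L^{ -1}(m)$. The Galois graph $G_L$ is the directed graph on $\mathcal{J}_L$ with an edge $j\to j'$ iff $j\ne j'$ and $j\not\le\kappa_L(j')$. For $x\in L$ let $J_L(x)=\{j\in\mathcal{J}_L:j\le x\}$ and $M_L(x)=\{j\in\mathcal{J}_L:\kappa_L(j)\ge x\}$. For a compatibly dismantlable $L$, for every cover $x\lessdot y$ the set $M_L(x)\cap J_L(y)$ has exactly one element $j_{xy}$; set $\mathcal{D}_L(x)=\{j_{yx}:y\lessdot x\}$ and $\mathcal{U}_L(x)=\{j_{xy}:x\lessdot y\}$. $L$ is semidistrim if it is compatibly dismantlable and $\mathcal{D}_L(x)$, $\mathcal{U}_L(x)$ are independent sets (no two elements adjacent) of $G_L$ for all $x\in L$. For semidistrim $L$, the maps $\mathcal{D}_L$ and $\mathcal{U}_L$ are bijections from $L$ to the set of independent sets of $G_L$, and rowmotion $\mathsf{Row}_L:L\to L$ is the bijection defined by $\mathcal{U}_L(\mathsf{Row}_L(x))=\mathcal{D}_L(x)$.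 For any lattice, $\mathsf{Pop}^\downarrow_L(x)=x\wedge\bigwedge\{y:y\lessdot x\}$ and $\mathsf{Pop}^\uparrow_L(x)=x\vee\bigvee\{y:x\lessdot y\}$. For a set $S$ of join-irreducibles, $\kappa_L(S)=\{\kappa_L(j):j\in S\}$. -}

module Defs where

open import Level using (0ℓ)
open import Data.Nat.Base using (ℕ) renaming (_≡ᵇ_ to _==ℕ_)
open import Data.Fin.Base using (Fin)
open import Data.Fin.Properties using (_≟_)
open import Data.Bool.Base using (Bool; true; false; not; T; if_then_else_) renaming (_∧_ to _&&_)
open import Data.List.Base using (List; allFin; filterᵇ; length; foldr)
open import Data.Bool.ListAction using (all; any)
open import Data.Product.Base using (Σ; _×_)
open import Data.Sum.Base using (_⊎_)
open import Algebra.Core using (Op₂)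
open import Relation.Binary.Core using (Rel)
open import Relation.Binary.Definitions using (Decidable)
open import Relation.Binary.PropositionalEquality using (_≡_; _≢_)
open import Relation.Binary.Lattice.Structures using (IsBoundedLattice)
open import Relation.Nullary using (¬_)
open import Relation.Nullary.Decidable using (⌊_⌋)

-- Since ⊥ : Fin n, the lattice is nonempty.

record FinLattice (n : ℕ) : Set₁ where
  field
    _≤_  : Rel (Fin n) 0ℓ
    _≤?_ : Decidable _≤_
    _∨_  : Op₂ (Fin n)
    _∧_  : Op₂ (Fin n)
    ⊤    : Fin n
    ⊥    : Fin n
    isBoundedLattice : IsBoundedLattice _≡_ _≤_ _∨_ _∧_ ⊤ ⊥

  infix  4 _≤_
  infixr 6 _∨_
  infixr 7 _∧_

module Notions {n : ℕ} (L : FinLattice n) where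
  open FinLattice L public

  elems : List (Fin n)
  elems = allFin n

  _≤ᵇ_ : Fin n → Fin n → Bool
  x ≤ᵇ y = ⌊ x ≤? y ⌋

  _=ᶠ_ : Fin n → Fin n → Bool
  x =ᶠ y = ⌊ x ≟ y ⌋

  _<ᵇ_ : Fin n → Fin n → Bool
  x <ᵇ y = (x ≤ᵇ y) && not (x =ᶠ y)

  _⋖ᵇ_ : Fin n → Fin n → Bool
  x ⋖ᵇ y = (x <ᵇ y) && all (λ z → not ((x <ᵇ z) && (z <ᵇ y))) elems

  _⋖_ : Fin n → Fin n → Set
  x ⋖ y = T (x ⋖ᵇ y)

  count : (Fin n → Bool) → ℕ
  count P = length (filterbP)
    where filterbP = filterᵇ P elems

  -- Intervals [a,b] of L.  An interval is convex, so its cover relation is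
  -- the restriction of that of L; its meets/joins are those of L.

  inIᵇ : Fin n → Fin n → Fin n → Bool
  inIᵇ a b z = (a ≤ᵇ z) && (z ≤ᵇ b)

  InI : Fin n → Fin n → Fin n → Set
  InI a b z = T (inIᵇ a b z)

  JIᵇ : Fin n → Fin n → Fin n → Bool
  JIᵇ a b j = inIᵇ a b j && (count (λ y → inIᵇ a b y && (y ⋖ᵇ j)) ==ℕ 1)

  MIᵇ : Fin n → Fin n → Fin n → Bool
  MIᵇ a b m = inIᵇ a b m && (count (λ y → inIᵇ a b y && (m ⋖ᵇ y)) ==ℕ 1)

  JI : Fin n → Fin n → Fin n → Set
  JI a b j = T (JIᵇ a b j)

  MI : Fin n → Fin n → Fin n → Set
  MI a b m = T (MIᵇ a b m)

  -- m ∈ M_[a,b](j) = max { z ∈ [a,b] : j_* = j ∧ z }   (j_* : the element covered by j)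
  InMof : Fin n → Fin n → Fin n → Fin n → Set
  InMof a b j m = InI a b m
    × (∀ js → InI a b js → js ⋖ j →
         (js ≡ j ∧ m) × (∀ z → InI a b z → js ≡ j ∧ z → m ≤ z → z ≡ m))

  -- j ∈ J_[a,b](m) = min { z ∈ [a,b] : m^* = m ∨ z }   (m^* : the element covering m)
  InJof : Fin n → Fin n → Fin n → Fin n → Set
  InJof a b m j = InI a b j
    × (∀ ms → InI a b ms → m ⋖ ms →
         (ms ≡ m ∨ j) × (∀ z → InI a b z → ms ≡ m ∨ z → z ≤ j → z ≡ j))

  IsPairing : Fin n → Fin n → (Fin n → Fin n) → Set
  IsPairing a b κ =
      (∀ j → JI a b j → MI a b (κ j) × InMof a b j (κ j) × InJof a b (κ j) j)
    × (∀ j j' → JI a b j → JI a b j' → κ j ≡ κ j' → j ≡ j')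
    × (∀ m → MI a b m → Σ (Fin n) (λ j → JI a b j × κ j ≡ m))

  UniquelyPaired : Fin n → Fin n → Set
  UniquelyPaired a b =
      Σ (Fin n → Fin n) (IsPairing a b)
    × (∀ κ κ' → IsPairing a b κ → IsPairing a b κ' → ∀ j → JI a b j → κ j ≡ κ' j)

  PrimePair : Fin n → Fin n → Fin n → Fin n → Set
  PrimePair a b j0 m0 = InI a b j0 × InI a b m0
    × (∀ z → InI a b z → (z ≤ m0 ⊎ j0 ≤ z) × ¬ (z ≤ m0 × j0 ≤ z))

  CondI : Fin n → Fin n → Fin n → Set
  CondI a b j0 = ∀ κ κ' → IsPairing a b κ → IsPairing j0 b κ' →
      (∀ j → JI a b j → j0 ≤ κ j → JI j0 b (j0 ∨ j) × κ' (j0 ∨ j) ≡ κ j)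
    × (∀ j j' → JI a b j → j0 ≤ κ j → JI a b j' → j0 ≤ κ j' → j0 ∨ j ≡ j0 ∨ j' → j ≡ j')
    × (∀ j' → JI j0 b j' → Σ (Fin n) (λ j → JI a b j × j0 ≤ κ j × j0 ∨ j ≡ j'))

  -- condition (ii) of compatible dismantlability
  -- (κ⁻¹(m) = j is expressed as  JI a b j × κ j ≡ m)
  CondII : Fin n → Fin n → Fin n → Set
  CondII a b m0 = ∀ κ κ'' → IsPairing a b κ → IsPairing a m0 κ'' →
      (∀ m j → MI a b m → JI a b j → κ j ≡ m → j ≤ m0 →
         MI a m0 (m0 ∧ m) × JI a m0 j × κ'' j ≡ m0 ∧ m)
    × (∀ m m' j j' → MI a b m → MI a b m' → JI a b j → JI a b j' →
         κ j ≡ m → κ j' ≡ m' → j ≤ m0 → j' ≤ m0 → m0 ∧ m ≡ m0 ∧ m' → m ≡ m')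
    × (∀ m' → MI a m0 m' → Σ (Fin n) (λ m → Σ (Fin n) (λ j →
         MI a b m × JI a b j × κ j ≡ m × j ≤ m0 × m0 ∧ m ≡ m')))

  -- the interval [a,b] is compatibly dismantlable
  data CD : Fin n → Fin n → Set where
    cd-one  : ∀ {a b} → UniquelyPaired a b → a ≡ b → CD a b
    cd-step : ∀ {a b} (j0 m0 : Fin n) → UniquelyPaired a b → PrimePair a b j0 m0 →
              CD j0 b → CondI a b j0 → CD a m0 → CondII a b m0 → CD a b

  JIL : Fin n → Set
  JIL = JI ⊥ ⊤

  Edge : (Fin n → Fin n) → Fin n → Fin n → Set
  Edge κ j j' = j ≢ j' × ¬ (j ≤ κ j')

  -- D_L(x) = { j : j ∈ M_L(y) ∩ J_L(x) for some y ⋖ x }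
  Dset : (Fin n → Fin n) → Fin n → Fin n → Bool
  Dset κ x j = JIᵇ ⊥ ⊤ j && any (λ y → (y ⋖ᵇ x) && ((j ≤ᵇ x) && (y ≤ᵇ κ j))) elems

  -- U_L(x) = { j : j ∈ M_L(x) ∩ J_L(y) for some x ⋖ y }
  Uset : (Fin n → Fin n) → Fin n → Fin n → Bool
  Uset κ x j = JIᵇ ⊥ ⊤ j && any (λ y → (x ⋖ᵇ y) && ((j ≤ᵇ y) && (x ≤ᵇ κ j))) elems

  Independent : (Fin n → Fin n) → (Fin n → Bool) → Set
  Independent κ S = ∀ j j' → T (S j) → T (S j') → ¬ Edge κ j j'

  -- L is semidistrim, and κ is its (unique) pairing κ_L
  Semidistrim : (Fin n → Fin n) → Set
  Semidistrim κ = IsPairing ⊥ ⊤ κ × CD ⊥ ⊤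
    × (∀ x → Independent κ (Dset κ x) × Independent κ (Uset κ x))

  -- big meet / join of f i over the i with P i  (empty meet = ⊤, empty join = ⊥)
  ⋀[_]_ : (Fin n → Bool) → (Fin n → Fin n) → Fin n
  ⋀[ P ] f = foldr (λ i acc → if P i then f i ∧ acc else acc) ⊤ elems

  ⋁[_]_ : (Fin n → Bool) → (Fin n → Fin n) → Fin n
  ⋁[ P ] f = foldr (λ i acc → if P i then f i ∨ acc else acc) ⊥ elems

  RowOf : (Fin n → Fin n) → Fin n → Fin n → Set
  RowOf κ x y = ∀ j → Uset κ y j ≡ Dset κ x j

  Pop↓ : Fin n → Fin n
  Pop↓ x = x ∧ (⋀[ (λ y → y ⋖ᵇ x) ] (λ y → y))

  Pop↑ : Fin n → Fin n
  Pop↑ x = x ∨ (⋁[ (λ y → x ⋖ᵇ y) ] (λ y → y))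

-- Every cover x ⋖ y carries a label: a join-irreducible j with j ≤ y and x ≤ κ j. Labels exist by
-- induction along the compatible dismantling, and since j ≰ κ j they determine the cover:
-- y = x ∨ j and x = y ∧ κ j. This yields x = ⋀ κ(U x) = ⋁ D x, the formulas for Pop↓ and Pop↑,
-- and injectivity of U and D.
--
-- Rowmotion needs more: every independent set of the Galois graph must be some U r (and some D r).
-- Following the dismantling once more, independent sets inject into L (top part through j ↦ j₀ ∨ j,
-- bottom part after discarding j₀), so the injection U from L into independent sets is onto by
-- pigeonhole. Hence Row x is the r with U r = D x, namely ⋀ κ(D x), and dually Row⁻¹ x = ⋁ U x.

module Submission where

open import Defs
open import Function.Base using (_∘_; id)
open import Function.Bundles using (Equivalence)
open import Function.Definitions using (Injective; StrictlySurjective)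
open import Data.Nat.Base using (ℕ; zero; suc)
open import Data.Nat.Properties using (≡ᵇ⇒≡; ≡⇒≡ᵇ; 1+n≰n)
open import Data.Fin.Base using (Fin; punchOut)
open import Data.Fin.Properties using (_≟_; any?; all?; ¬∀⟶∃¬; injective⇒≤; punchOut-injective)
open import Data.Bool.Base using (Bool; true; false; not; T; if_then_else_) renaming (_∧_ to _&&_)
open import Data.Bool.Properties using (T-∧)
open import Data.Bool.ListAction using (all; any)
open import Data.List.Base using (List; []; _∷_; filterᵇ; length; foldr)
open import Data.List.Membership.Propositional using (_∈_; lose)
open import Data.List.Membership.Propositional.Properties using (∈-allFin; ∈-filter⁻)
open import Data.List.Relation.Unary.Any using (here; there; satisfied)
open import Data.List.Relation.Unary.All using (All; []; _∷_; universal) renaming (lookup to All-lookup; map to All-map)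
open import Data.List.Relation.Unary.All.Properties using (all⁺; all⁻)
open import Data.List.Relation.Unary.Any.Properties using (any⁺; any⁻)
open import Data.List.Relation.Unary.Unique.Propositional using (Unique)
open import Data.List.Relation.Unary.AllPairs using (_∷_)
open import Data.List.Relation.Unary.Unique.Propositional.Properties using (allFin⁺)
open import Data.List.Properties using (filter-none)
open import Data.Product.Base using (∃; _×_; _,_; proj₁; proj₂)
open import Data.Sum.Base using (_⊎_; inj₁; inj₂; [_,_]′)
open import Data.Unit.Base using (tt)
open import Relation.Binary.PropositionalEquality using (_≡_; _≢_; refl; sym; trans; cong; subst)
open import Relation.Binary.Lattice.Structures using (IsBoundedLattice)
open import Relation.Nullary using (¬_; Dec; yes; no; contradiction)
open import Relation.Nullary.Decidable
  using (¬?; _→-dec_; _×-dec_; T?; toWitness; fromWitness; toWitnessFalse; fromWitnessFalse; decidable-stable)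

&&⁻ : ∀ {a b} → T (a && b) → T a × T b
&&⁻ {a} = Equivalence.to (T-∧ {a})

&&⁺ : ∀ {a b} → T a → T b → T (a && b)
&&⁺ p q = Equivalence.from T-∧ (p , q)

T-not⇒¬T : ∀ {b} → T (not b) → ¬ T b
T-not⇒¬T {false} _ ()

¬T⇒T-not : ∀ {b} → ¬ T b → T (not b)
¬T⇒T-not {false} _  = tt
¬T⇒T-not {true}  ¬b = ¬b tt

T-injective : ∀ {a b} → (T a → T b) → (T b → T a) → a ≡ b
T-injective {true}  {true}  _ _ = refl
T-injective {true}  {false} f _ = contradiction tt f
T-injective {false} {true}  _ g = contradiction tt g
T-injective {false} {false} _ _ = refl

module _ {A : Set} (p : A → Bool) where

  filterᵇ-nonempty : ∀ xs {k} → length (filterᵇ p xs) ≡ suc k → ∃ (T ∘ p)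
  filterᵇ-nonempty xs eq with filterᵇ p xs in fxs
  ... | z ∷ _ = z , proj₂ (∈-filter⁻ (T? ∘ p) {xs = xs} (subst (z ∈_) (sym fxs) (here refl)))

  filterᵇ-singleton : ∀ {xs y} → Unique xs → y ∈ xs → T (p y) → (∀ z → T (p z) → z ≡ y) →
                      length (filterᵇ p xs) ≡ 1
  filterᵇ-singleton {x ∷ xs} (x∉xs ∷ _) (here refl) py only with p x
  ... | true  = cong (λ ys → suc (length ys))
                  (filter-none (T? ∘ p) (All-map (λ x≢z pz → x≢z (sym (only _ pz))) x∉xs))
  filterᵇ-singleton {x ∷ xs} (x∉xs ∷ uxs) (there y∈xs) py only with p x in px
  ... | true  = contradiction (only x (subst T (sym px) tt)) (All-lookup x∉xs y∈xs)
  ... | false = filterᵇ-singleton uxs y∈xs py only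

module _ {A : Set} {_≺_ : A → A → Set} (≺? : ∀ x y → Dec (x ≺ y))
         (≺-irrefl : ∀ {x} → ¬ x ≺ x) (≺-trans : ∀ {x y z} → x ≺ y → y ≺ z → x ≺ z)
         {P : A → Set} (P? : ∀ x → Dec (P x)) where

  minimal-or-none : (xs : List A) →
    All (¬_ ∘ P) xs ⊎ ∃ λ w → P w × (∀ {z} → z ∈ xs → P z → ¬ z ≺ w)
  minimal-or-none [] = inj₁ []
  minimal-or-none (x ∷ xs) with minimal-or-none xs | P? x
  ... | inj₁ none | no ¬px = inj₁ (¬px ∷ none)
  ... | inj₁ none | yes px = inj₂ (x , px , λ { (here refl) _ → ≺-irrefl ; (there z∈) pz _ → All-lookup none z∈ pz })
  ... | inj₂ (w , pw , min) | no ¬px = inj₂ (w , pw , λ { (here refl) px → contradiction px ¬px ; (there z∈) → min z∈ })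
  ... | inj₂ (w , pw , min) | yes px with ≺? x w
  ...   | yes x≺w = inj₂ (x , px , λ { (here refl) _ → ≺-irrefl ; (there z∈) pz z≺x → min z∈ pz (≺-trans z≺x x≺w) })
  ...   | no  x⊀w = inj₂ (w , pw , λ { (here refl) _ → x⊀w ; (there z∈) → min z∈ })

  minimal : ∀ {xs z} → z ∈ xs → P z → ∃ λ w → P w × (∀ {u} → u ∈ xs → P u → ¬ u ≺ w)
  minimal {xs} z∈xs pz with minimal-or-none xs
  ... | inj₁ none = contradiction pz (All-lookup none z∈xs)
  ... | inj₂ min  = min

injective⇒strictlySurjective : ∀ {n} {f : Fin n → Fin n} → Injective _≡_ _≡_ f → StrictlySurjective _≡_ f
injective⇒strictlySurjective {zero}  _   ()
injective⇒strictlySurjective {suc m} {f} inj t with any? (λ i → f i ≟ t)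
... | yes hit = hit
... | no miss = contradiction (injective⇒≤ f′-injective) 1+n≰n
  where
    t≢f : ∀ i → t ≢ f i
    t≢f i eq = miss (i , sym eq)
    f′ : Fin (suc m) → Fin m
    f′ i = punchOut (t≢f i)
    f′-injective : Injective _≡_ _≡_ f′
    f′-injective eq = inj (punchOut-injective (t≢f _) (t≢f _) eq)

module LatticeProperties {n : ℕ} (L : FinLattice n) where
  open Notions L public
  open IsBoundedLattice isBoundedLattice public
    using (antisym; x≤x∨y; y≤x∨y; ∨-least; x∧y≤x; x∧y≤y; ∧-greatest; maximum; minimum)
    renaming (refl to ≤-refl; trans to ≤-trans)

  Subset : Set
  Subset = Fin n → Bool

  infix 4 _⊆_ _<_

  _⊆_ : Subset → Subset → Set
  S ⊆ S′ = ∀ {j} → T (S j) → T (S′ j)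

  any-elems⁺ : ∀ {p : Fin n → Bool} z → T (p z) → T (any p elems)
  any-elems⁺ {p} z pz = any⁺ p (lose (∈-allFin z) pz)

  any-elems⁻ : ∀ {p : Fin n → Bool} → T (any p elems) → ∃ (T ∘ p)
  any-elems⁻ {p} h = satisfied (any⁻ p elems h)

  all-elems⁺ : ∀ {p : Fin n → Bool} → (∀ z → T (p z)) → T (all p elems)
  all-elems⁺ {p} f = all⁻ p (universal f elems)

  all-elems⁻ : ∀ {p : Fin n → Bool} → T (all p elems) → ∀ z → T (p z)
  all-elems⁻ {p} h z = All-lookup (all⁺ p elems h) (∈-allFin z)

  x≤y⇒x∧y≡x : ∀ {x y} → x ≤ y → x ∧ y ≡ x
  x≤y⇒x∧y≡x x≤y = antisym (x∧y≤x _ _) (∧-greatest ≤-refl x≤y)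

  _<_ : Fin n → Fin n → Set
  x < y = x ≤ y × x ≢ y

  _<?_ : ∀ x y → Dec (x < y)
  x <? y = (x ≤? y) ×-dec ¬? (x ≟ y)

  <-irrefl : ∀ {x} → ¬ x < x
  <-irrefl (_ , x≢x) = x≢x refl

  <-≤-trans : ∀ {x y z} → x < y → y ≤ z → x < z
  <-≤-trans (x≤y , x≢y) y≤z = ≤-trans x≤y y≤z , λ { refl → x≢y (antisym x≤y y≤z) }

  <-trans : ∀ {x y z} → x < y → y < z → x < z
  <-trans x<y (y≤z , _) = <-≤-trans x<y y≤z

  ≤⇒≡⊎< : ∀ {x y} → x ≤ y → x ≡ y ⊎ x < y
  ≤⇒≡⊎< {x} {y} x≤y with x ≟ y
  ... | yes x≡y = inj₁ x≡y
  ... | no  x≢y = inj₂ (x≤y , x≢y)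

  <ᵇ⇒< : ∀ {x y} → T (x <ᵇ y) → x < y
  <ᵇ⇒< {x} h = let x≤y , x≢y = &&⁻ {x ≤ᵇ _} h in toWitness x≤y , toWitnessFalse x≢y

  <⇒<ᵇ : ∀ {x y} → x < y → T (x <ᵇ y)
  <⇒<ᵇ {x} (x≤y , x≢y) = &&⁺ {x ≤ᵇ _} (fromWitness x≤y) (fromWitnessFalse x≢y)

  ⋖⇒< : ∀ {x y} → x ⋖ y → x < y
  ⋖⇒< {x} h = <ᵇ⇒< (proj₁ (&&⁻ {x <ᵇ _} h))

  ⋖⇒nothingBetween : ∀ {x y u} → x ⋖ y → x < u → ¬ u < y
  ⋖⇒nothingBetween {x} {y} {u} h x<u u<y =
    T-not⇒¬T (all-elems⁻ (proj₂ (&&⁻ {x <ᵇ y} h)) u) (&&⁺ (<⇒<ᵇ x<u) (<⇒<ᵇ u<y))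

  ⋖-intro : ∀ {x y} → x < y → (∀ {u} → x < u → ¬ u < y) → x ⋖ y
  ⋖-intro {x} x<y between = &&⁺ {x <ᵇ _} (<⇒<ᵇ x<y) (all-elems⁺ (λ u → ¬T⇒T-not (λ h →
    let x<u , u<y = &&⁻ {x <ᵇ u} h in between (<ᵇ⇒< x<u) (<ᵇ⇒< u<y))))

  ⋖-between : ∀ {x y u} → x ⋖ y → x ≤ u → u ≤ y → u ≡ x ⊎ u ≡ y
  ⋖-between x⋖y x≤u u≤y with ≤⇒≡⊎< x≤u | ≤⇒≡⊎< u≤y
  ... | inj₁ x≡u | _         = inj₁ (sym x≡u)
  ... | inj₂ _   | inj₁ u≡y  = inj₂ u≡y
  ... | inj₂ x<u | inj₂ u<y  = contradiction u<y (⋖⇒nothingBetween x⋖y x<u)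

  cover-above : ∀ {x z} → x < z → ∃ λ y → x ⋖ y × y ≤ z
  cover-above {x} {z} x<z
    with minimal _<?_ <-irrefl <-trans (λ w → (x <? w) ×-dec (w ≤? z)) (∈-allFin z) (x<z , ≤-refl)
  ... | y , (x<y , y≤z) , min =
    y , ⋖-intro x<y (λ x<u u<y → min (∈-allFin _) (x<u , ≤-trans (proj₁ u<y) y≤z) u<y) , y≤z

  cover-below : ∀ {z y} → z < y → ∃ λ c → z ≤ c × c ⋖ y
  cover-below {z} {y} z<y
    with minimal {_≺_ = λ u v → v < u} (λ u v → v <? u) <-irrefl (λ p q → <-trans q p)
                 (λ w → (z ≤? w) ×-dec (w <? y)) (∈-allFin z) (≤-refl , z<y)
  ... | c , (z≤c , c<y) , max =
    c , z≤c , ⋖-intro c<y (λ c<u u<y → max (∈-allFin _) (≤-trans z≤c (proj₁ c<u) , u<y) c<u)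

  InI⁻ : ∀ {a b z} → InI a b z → a ≤ z × z ≤ b
  InI⁻ {a} h = let a≤z , z≤b = &&⁻ {a ≤ᵇ _} h in toWitness a≤z , toWitness z≤b

  InI⁺ : ∀ {a b z} → a ≤ z → z ≤ b → InI a b z
  InI⁺ {a} a≤z z≤b = &&⁺ {a ≤ᵇ _} (fromWitness a≤z) (fromWitness z≤b)

  InI-whole : ∀ z → InI ⊥ ⊤ z
  InI-whole z = InI⁺ (minimum z) (maximum z)

  InI[a,a]⇒≡ : ∀ {a z} → InI a a z → z ≡ a
  InI[a,a]⇒≡ z∈ = let a≤z , z≤a = InI⁻ z∈ in antisym z≤a a≤z

  JI⇒InI : ∀ {a b j} → JI a b j → InI a b j
  JI⇒InI {a} {b} {j} h = proj₁ (&&⁻ {inIᵇ a b j} h)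

  JI⇒lowerCover : ∀ {a b j} → JI a b j → ∃ λ j₋ → InI a b j₋ × j₋ ⋖ j
  JI⇒lowerCover {a} {b} {j} h
    with z , pz ← filterᵇ-nonempty (λ y → inIᵇ a b y && (y ⋖ᵇ j)) elems
                    (≡ᵇ⇒≡ _ 1 (proj₂ (&&⁻ {inIᵇ a b j} h)))
    = z , &&⁻ {inIᵇ a b z} pz

  JI-intro : ∀ {a b j j₋} → InI a b j → InI a b j₋ → j₋ ⋖ j →
             (∀ y → InI a b y → y ⋖ j → y ≡ j₋) → JI a b j
  JI-intro {a} {b} {j} j∈ j₋∈ j₋⋖j unique = &&⁺ j∈ (≡⇒≡ᵇ _ 1
    (filterᵇ-singleton (λ y → inIᵇ a b y && (y ⋖ᵇ j)) (allFin⁺ n) (∈-allFin _) (&&⁺ j₋∈ j₋⋖j)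
       (λ z pz → let z∈ , z⋖j = &&⁻ {inIᵇ a b z} pz in unique z z∈ z⋖j)))

  ¬JI[a,a] : ∀ {a j} → ¬ JI a a j
  ¬JI[a,a] j-JI with j₋ , j₋∈ , j₋⋖j ← JI⇒lowerCover j-JI =
    proj₂ (⋖⇒< j₋⋖j) (trans (InI[a,a]⇒≡ j₋∈) (sym (InI[a,a]⇒≡ (JI⇒InI j-JI))))

  module _ {P : Subset} {f : Fin n → Fin n} where

    ⋀-lowerBound : ∀ {i} → T (P i) → ⋀[ P ] f ≤ f i
    ⋀-lowerBound {i} = go elems (∈-allFin i)
      where
        go : ∀ xs → i ∈ xs → T (P i) → foldr (λ k acc → if P k then f k ∧ acc else acc) ⊤ xs ≤ f i
        go (x ∷ xs) (here refl) pi with P x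
        ... | true  = x∧y≤x _ _
        go (x ∷ xs) (there i∈) pi with P x
        ... | true  = ≤-trans (x∧y≤y _ _) (go xs i∈ pi)
        ... | false = go xs i∈ pi

    ⋀-greatest : ∀ {z} → (∀ i → T (P i) → z ≤ f i) → z ≤ ⋀[ P ] f
    ⋀-greatest {z} bound = go elems
      where
        go : ∀ xs → z ≤ foldr (λ k acc → if P k then f k ∧ acc else acc) ⊤ xs
        go []       = maximum z
        go (x ∷ xs) with P x in px
        ... | true  = ∧-greatest (bound x (subst T (sym px) tt)) (go xs)
        ... | false = go xs

    ⋁-upperBound : ∀ {i} → T (P i) → f i ≤ ⋁[ P ] f
    ⋁-upperBound {i} = go elems (∈-allFin i)
      where
        go : ∀ xs → i ∈ xs → T (P i) → f i ≤ foldr (λ k acc → if P k then f k ∨ acc else acc) ⊥ xs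
        go (x ∷ xs) (here refl) pi with P x
        ... | true  = x≤x∨y _ _
        go (x ∷ xs) (there i∈) pi with P x
        ... | true  = ≤-trans (go xs i∈ pi) (y≤x∨y _ _)
        ... | false = go xs i∈ pi

    ⋁-least : ∀ {z} → (∀ i → T (P i) → f i ≤ z) → ⋁[ P ] f ≤ z
    ⋁-least {z} bound = go elems
      where
        go : ∀ xs → foldr (λ k acc → if P k then f k ∨ acc else acc) ⊥ xs ≤ z
        go []       = minimum z
        go (x ∷ xs) with P x in px
        ... | true  = ∨-least (bound x (subst T (sym px) tt)) (go xs)
        ... | false = go xs

  ⋀-cong : ∀ {P Q : Subset} {f} → (∀ i → P i ≡ Q i) → ⋀[ P ] f ≡ ⋀[ Q ] f
  ⋀-cong {P} {Q} P≗Q = antisym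
    (⋀-greatest (λ i qi → ⋀-lowerBound {P} (subst T (sym (P≗Q i)) qi)))
    (⋀-greatest (λ i pi → ⋀-lowerBound {Q} (subst T (P≗Q i) pi)))

  ⋁-cong : ∀ {P Q : Subset} {f} → (∀ i → P i ≡ Q i) → ⋁[ P ] f ≡ ⋁[ Q ] f
  ⋁-cong {P} {Q} P≗Q = antisym
    (⋁-least (λ i pi → ⋁-upperBound {Q} (subst T (P≗Q i) pi)))
    (⋁-least (λ i qi → ⋁-upperBound {P} (subst T (sym (P≗Q i)) qi)))

  module PairingProperties {a b : Fin n} {κ : Fin n → Fin n} (isPairing : IsPairing a b κ) where

    κ-MI : ∀ {j} → JI a b j → MI a b (κ j)
    κ-MI j-JI = proj₁ (proj₁ isPairing _ j-JI)

    κ-InI : ∀ {j} → JI a b j → InI a b (κ j)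
    κ-InI j-JI = proj₁ (proj₁ (proj₂ (proj₁ isPairing _ j-JI)))

    κ-lowerCover : ∀ {j j₋} → JI a b j → InI a b j₋ → j₋ ⋖ j → j₋ ≡ j ∧ κ j
    κ-lowerCover j-JI j₋∈ j₋⋖j = proj₁ (proj₂ (proj₁ (proj₂ (proj₁ isPairing _ j-JI))) _ j₋∈ j₋⋖j)

    κ-injective : ∀ {j j′} → JI a b j → JI a b j′ → κ j ≡ κ j′ → j ≡ j′
    κ-injective = proj₁ (proj₂ isPairing) _ _

    κ-maximal : ∀ {j j₋ z} → JI a b j → InI a b j₋ → j₋ ⋖ j → InI a b z → j₋ ≡ j ∧ z → κ j ≤ z → z ≡ κ j
    κ-maximal j-JI j₋∈ j₋⋖j = proj₂ (proj₂ (proj₁ (proj₂ (proj₁ isPairing _ j-JI))) _ j₋∈ j₋⋖j) _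

    j≰κj : ∀ {j} → JI a b j → ¬ j ≤ κ j
    j≰κj j-JI j≤κj with j₋ , j₋∈ , j₋⋖j ← JI⇒lowerCover j-JI =
      proj₂ (⋖⇒< j₋⋖j) (trans (κ-lowerCover j-JI j₋∈ j₋⋖j) (x≤y⇒x∧y≡x j≤κj))

    ⋖⇒∧κ≡ : ∀ {x y j} → y ⋖ x → JI a b j → j ≤ x → y ≤ κ j → x ∧ κ j ≡ y
    ⋖⇒∧κ≡ y⋖x j-JI j≤x y≤κj with ⋖-between y⋖x (∧-greatest (proj₁ (⋖⇒< y⋖x)) y≤κj) (x∧y≤x _ _)
    ... | inj₁ x∧κj≡y = x∧κj≡y
    ... | inj₂ x∧κj≡x = contradiction (≤-trans j≤x (subst (_≤ κ _) x∧κj≡x (x∧y≤y _ _))) (j≰κj j-JI)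

    ⋖⇒∨≡ : ∀ {x y j} → x ⋖ y → JI a b j → j ≤ y → x ≤ κ j → x ∨ j ≡ y
    ⋖⇒∨≡ {j = j} x⋖y j-JI j≤y x≤κj with ⋖-between x⋖y (x≤x∨y _ _) (∨-least (proj₁ (⋖⇒< x⋖y)) j≤y)
    ... | inj₂ x∨j≡y = x∨j≡y
    ... | inj₁ x∨j≡x = contradiction (≤-trans (subst (j ≤_) x∨j≡x (y≤x∨y _ _)) x≤κj) (j≰κj j-JI)

    <⇒≤κ : ∀ {j z} → JI a b j → InI a b z → z < j → z ≤ κ j
    <⇒≤κ j-JI z∈ z<j with c , z≤c , c⋖j ← cover-below z<j =
      ≤-trans z≤c (subst (_≤ κ _) (sym (κ-lowerCover j-JI c∈ c⋖j)) (x∧y≤y _ _))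
      where
        c∈ : InI a b c
        c∈ = InI⁺ (≤-trans (proj₁ (InI⁻ z∈)) z≤c) (≤-trans (proj₁ (⋖⇒< c⋖j)) (proj₂ (InI⁻ (JI⇒InI j-JI))))

  module PrimePairProperties {a b j₀ m₀ : Fin n} (primePair : PrimePair a b j₀ m₀) where

    j₀∈ : InI a b j₀
    j₀∈ = proj₁ primePair

    m₀∈ : InI a b m₀
    m₀∈ = proj₁ (proj₂ primePair)

    ≤m₀⊎j₀≤ : ∀ {z} → InI a b z → z ≤ m₀ ⊎ j₀ ≤ z
    ≤m₀⊎j₀≤ z∈ = proj₁ (proj₂ (proj₂ primePair) _ z∈)

    ≤m₀⇒j₀≰ : ∀ {z} → InI a b z → z ≤ m₀ → ¬ j₀ ≤ z
    ≤m₀⇒j₀≰ z∈ z≤m₀ j₀≤z = proj₂ (proj₂ (proj₂ primePair) _ z∈) (z≤m₀ , j₀≤z)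

    j₀≰m₀ : ¬ j₀ ≤ m₀
    j₀≰m₀ j₀≤m₀ = ≤m₀⇒j₀≰ j₀∈ j₀≤m₀ ≤-refl

    j₀≰⇒≤m₀ : ∀ {z} → InI a b z → ¬ j₀ ≤ z → z ≤ m₀
    j₀≰⇒≤m₀ z∈ j₀≰z = [ id , (λ j₀≤z → contradiction j₀≤z j₀≰z) ]′ (≤m₀⊎j₀≤ z∈)

    top∩bottom≡∅ : ∀ {z} → InI j₀ b z → ¬ InI a m₀ z
    top∩bottom≡∅ z∈top z∈bottom =
      let j₀≤z , z≤b = InI⁻ z∈top in
      ≤m₀⇒j₀≰ (InI⁺ (≤-trans (proj₁ (InI⁻ j₀∈)) j₀≤z) z≤b) (proj₂ (InI⁻ z∈bottom)) j₀≤z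

    j₀∧m₀∈ : InI a b (j₀ ∧ m₀)
    j₀∧m₀∈ = InI⁺ (∧-greatest (proj₁ (InI⁻ j₀∈)) (proj₁ (InI⁻ m₀∈)))
                  (≤-trans (x∧y≤x _ _) (proj₂ (InI⁻ j₀∈)))

    j₀∧m₀<j₀ : j₀ ∧ m₀ < j₀
    j₀∧m₀<j₀ = x∧y≤x _ _ , λ eq → j₀≰m₀ (subst (_≤ m₀) eq (x∧y≤y _ _))

    <j₀⇒≤j₀∧m₀ : ∀ {u} → InI a b u → u < j₀ → u ≤ j₀ ∧ m₀
    <j₀⇒≤j₀∧m₀ u∈ (u≤j₀ , u≢j₀) with ≤m₀⊎j₀≤ u∈
    ... | inj₁ u≤m₀ = ∧-greatest u≤j₀ u≤m₀
    ... | inj₂ j₀≤u = contradiction (antisym u≤j₀ j₀≤u) u≢j₀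

    j₀∧m₀⋖j₀ : (j₀ ∧ m₀) ⋖ j₀
    j₀∧m₀⋖j₀ = ⋖-intro j₀∧m₀<j₀ λ {u} j₀∧m₀<u u<j₀ →
      proj₂ j₀∧m₀<u (antisym (proj₁ j₀∧m₀<u) (<j₀⇒≤j₀∧m₀ (u∈ j₀∧m₀<u u<j₀) u<j₀))
      where
        u∈ : ∀ {u} → j₀ ∧ m₀ < u → u < j₀ → InI a b u
        u∈ (l , _) (r , _) = InI⁺ (≤-trans (proj₁ (InI⁻ j₀∧m₀∈)) l) (≤-trans r (proj₂ (InI⁻ j₀∈)))

    j₀-JI : JI a b j₀
    j₀-JI = JI-intro j₀∈ j₀∧m₀∈ j₀∧m₀⋖j₀ λ y y∈ y⋖j₀ →
      [ sym , (λ eq → contradiction eq (proj₂ j₀∧m₀<j₀)) ]′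
        (⋖-between y⋖j₀ (<j₀⇒≤j₀∧m₀ y∈ (⋖⇒< y⋖j₀)) (x∧y≤x _ _))

    κj₀≡m₀ : ∀ {κ} → IsPairing a b κ → κ j₀ ≡ m₀
    κj₀≡m₀ {κ} isPairing = sym (κ-maximal j₀-JI j₀∧m₀∈ j₀∧m₀⋖j₀ m₀∈ refl κj₀≤m₀)
      where
        open PairingProperties isPairing
        κj₀≤m₀ : κ j₀ ≤ m₀
        κj₀≤m₀ = [ id , (λ j₀≤κj₀ → contradiction j₀≤κj₀ (j≰κj j₀-JI)) ]′ (≤m₀⊎j₀≤ (κ-InI j₀-JI))

  pairingOf : ∀ {a b} → CD a b → Fin n → Fin n
  pairingOf (cd-one up _)              = proj₁ (proj₁ up)
  pairingOf (cd-step _ _ up _ _ _ _ _) = proj₁ (proj₁ up)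

  pairingOf-isPairing : ∀ {a b} (d : CD a b) → IsPairing a b (pairingOf d)
  pairingOf-isPairing (cd-one up _)              = proj₂ (proj₁ up)
  pairingOf-isPairing (cd-step _ _ up _ _ _ _ _) = proj₂ (proj₁ up)

  -- The paper's j_{xy} ∈ M(x) ∩ J(y); it is unique, but only its existence is needed.
  CoverLabel : Fin n → Fin n → (Fin n → Fin n) → Fin n → Fin n → Set
  CoverLabel a b κ x y = ∃ λ j → JI a b j × j ≤ y × x ≤ κ j

  label-from-top : ∀ {a b j₀ κ κ′ x y} → IsPairing a b κ → IsPairing j₀ b κ′ → CondI a b j₀ →
                   CoverLabel j₀ b κ′ x y → CoverLabel a b κ x y
  label-from-top {κ′ = κ′} {x} isP isP′ condI (j′ , j′-JI , j′≤y , x≤κ′j′) =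
    let lift , _ , onto = condI _ _ isP isP′
        j , j-JI , j₀≤κj , j₀∨j≡j′ = onto j′ j′-JI
    in j , j-JI , ≤-trans (subst (j ≤_) j₀∨j≡j′ (y≤x∨y _ _)) j′≤y ,
       subst (x ≤_) (trans (cong κ′ (sym j₀∨j≡j′)) (proj₂ (lift j j-JI j₀≤κj))) x≤κ′j′

  label-from-bottom : ∀ {a b m₀ κ κ″ x y} → IsPairing a b κ → IsPairing a m₀ κ″ → CondII a b m₀ →
                      CoverLabel a m₀ κ″ x y → CoverLabel a b κ x y
  label-from-bottom {m₀ = m₀} {κ} {κ″} isP isP″ condII (j , j-JI , j≤y , x≤κ″j) =
    let restrict , _ , onto = condII _ _ isP isP″
        m , j₁ , m-MI , j₁-JI , κj₁≡m , j₁≤m₀ , m₀∧m≡κ″j = onto (κ″ j) (κ-MI j-JI)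
        _ , j₁-JI″ , κ″j₁≡m₀∧m = restrict m j₁ m-MI j₁-JI κj₁≡m j₁≤m₀
        j₁≡j = κ-injective j₁-JI″ j-JI (trans κ″j₁≡m₀∧m m₀∧m≡κ″j)
    in j₁ , j₁-JI , subst (_≤ _) (sym j₁≡j) j≤y ,
       ≤-trans x≤κ″j (subst (_≤ κ j₁) m₀∧m≡κ″j (subst (λ w → m₀ ∧ w ≤ κ j₁) κj₁≡m (x∧y≤y _ _)))
    where open PairingProperties isP″

  coverLabel : ∀ {a b κ x y} → CD a b → IsPairing a b κ → InI a b x → InI a b y → x ⋖ y →
               CoverLabel a b κ x y
  coverLabel (cd-one _ refl) _ x∈ y∈ x⋖y =
    contradiction (trans (InI[a,a]⇒≡ x∈) (sym (InI[a,a]⇒≡ y∈))) (proj₂ (⋖⇒< x⋖y))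
  coverLabel {x = x} (cd-step j₀ m₀ _ pp cdT condI cdB condII) isP x∈ y∈ x⋖y
    with PrimePairProperties.≤m₀⊎j₀≤ pp x∈ | PrimePairProperties.≤m₀⊎j₀≤ pp y∈
  ... | inj₂ j₀≤x | _ =
    label-from-top isP (pairingOf-isPairing cdT) condI (coverLabel cdT (pairingOf-isPairing cdT)
      (InI⁺ j₀≤x (proj₂ (InI⁻ x∈))) (InI⁺ (≤-trans j₀≤x (proj₁ (⋖⇒< x⋖y))) (proj₂ (InI⁻ y∈))) x⋖y)
  ... | inj₁ x≤m₀ | inj₂ j₀≤y =
    j₀ , PrimePairProperties.j₀-JI pp , j₀≤y , subst (x ≤_) (sym (PrimePairProperties.κj₀≡m₀ pp isP)) x≤m₀
  ... | inj₁ x≤m₀ | inj₁ y≤m₀ =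
    label-from-bottom isP (pairingOf-isPairing cdB) condII (coverLabel cdB (pairingOf-isPairing cdB)
      (InI⁺ (proj₁ (InI⁻ x∈)) x≤m₀) (InI⁺ (proj₁ (InI⁻ y∈)) y≤m₀) x⋖y)

  -- j ≤ κ j′ for distinct members says there is no edge j → j′ of the Galois graph.
  record IsIndependent (a b : Fin n) (κ : Fin n → Fin n) (S : Subset) : Set where
    field
      JI-members : ∀ {j} → T (S j) → JI a b j
      ≤κ         : ∀ {j j′} → T (S j) → T (S j′) → j ≢ j′ → j ≤ κ j′

  open IsIndependent

  image : (Fin n → Fin n) → Subset → Subset
  image f S y = any (λ j → S j && (f j =ᶠ y)) elems

  image⁺ : ∀ f S {j} → T (S j) → T (image f S (f j))
  image⁺ f S {j} j∈S = any-elems⁺ j (&&⁺ {S j} j∈S (fromWitness refl))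

  image⁻ : ∀ f S {y} → T (image f S y) → ∃ λ j → T (S j) × f j ≡ y
  image⁻ f S h with j , p ← any-elems⁻ h = let j∈S , fj≡y = &&⁻ {S j} p in j , j∈S , toWitness fj≡y

  remove : Fin n → Subset → Subset
  remove j₀ S j = S j && not (j =ᶠ j₀)

  remove⁺ : ∀ j₀ S {j} → T (S j) → j ≢ j₀ → T (remove j₀ S j)
  remove⁺ j₀ S {j} j∈S j≢j₀ = &&⁺ {S j} j∈S (fromWitnessFalse j≢j₀)

  remove⁻ : ∀ j₀ S {j} → T (remove j₀ S j) → T (S j) × j ≢ j₀
  remove⁻ j₀ S {j} h = let j∈S , j≢j₀ = &&⁻ {S j} h in j∈S , toWitnessFalse j≢j₀

  AllAbove : (Fin n → Fin n) → Fin n → Subset → Set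
  AllAbove κ j₀ S = ∀ j → T (S j) → j₀ ≤ κ j

  allAbove? : ∀ κ j₀ S → Dec (AllAbove κ j₀ S)
  allAbove? κ j₀ S = all? (λ j → T? (S j) →-dec (j₀ ≤? κ j))

  ¬allAbove⇒witness : ∀ {κ j₀ S} → ¬ AllAbove κ j₀ S → ∃ λ s → T (S s) × ¬ j₀ ≤ κ s
  ¬allAbove⇒witness {κ} {j₀} {S} ¬above
    with s , ¬s∈S⇒j₀≤κs ← ¬∀⟶∃¬ n _ (λ j → T? (S j) →-dec (j₀ ≤? κ j)) ¬above =
    s , decidable-stable (T? (S s)) (λ s∉S → ¬s∈S⇒j₀≤κs (λ s∈S → contradiction s∈S s∉S)) ,
    λ j₀≤κs → ¬s∈S⇒j₀≤κs (λ _ → j₀≤κs)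

  -- Following the dismantling, a set whose κ-images all lie in [j₀,b] is sent into the top part via
  -- j ↦ j₀ ∨ j; any other set loses j₀ and is sent into [a,m₀]. This is injective on independent sets.
  encode : ∀ {a b} → CD a b → (Fin n → Fin n) → Subset → Fin n
  encode {a} (cd-one _ _) κ S = a
  encode (cd-step j₀ m₀ _ _ cdT _ cdB _) κ S with allAbove? κ j₀ S
  ... | yes _ = encode cdT (pairingOf cdT) (image (j₀ ∨_) S)
  ... | no  _ = encode cdB (pairingOf cdB) (remove j₀ S)

  encode-InI : ∀ {a b} (d : CD a b) κ S → InI a b (encode d κ S)
  encode-InI (cd-one _ refl) κ S = InI⁺ ≤-refl ≤-refl
  encode-InI (cd-step j₀ m₀ _ pp cdT _ cdB _) κ S with allAbove? κ j₀ S
  ... | yes _ = let j₀≤z , z≤b = InI⁻ (encode-InI cdT _ _) in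
                InI⁺ (≤-trans (proj₁ (InI⁻ (PrimePairProperties.j₀∈ pp))) j₀≤z) z≤b
  ... | no  _ = let a≤z , z≤m₀ = InI⁻ (encode-InI cdB _ _) in
                InI⁺ a≤z (≤-trans z≤m₀ (proj₂ (InI⁻ (PrimePairProperties.m₀∈ pp))))

  image-independent : ∀ {a b j₀ κ κ′ S} → IsPairing a b κ → IsPairing j₀ b κ′ → CondI a b j₀ →
    IsIndependent a b κ S → AllAbove κ j₀ S → IsIndependent j₀ b κ′ (image (j₀ ∨_) S)
  image-independent {b = b} {j₀} {κ} {κ′} {S} isP isP′ condI indep above = record
    { JI-members = λ h → let j , j∈S , j₀∨j≡y = image⁻ (j₀ ∨_) S h in
                         subst (JI j₀ b) j₀∨j≡y (proj₁ (lift (JI-members indep j∈S) (above _ j∈S)))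
    ; ≤κ         = image-≤κ′
    }
    where
      lift : ∀ {j} → JI _ b j → j₀ ≤ κ j → JI j₀ b (j₀ ∨ j) × κ′ (j₀ ∨ j) ≡ κ j
      lift = proj₁ (condI _ _ isP isP′) _

      image-≤κ′ : ∀ {y₁ y₂} → T (image (j₀ ∨_) S y₁) → T (image (j₀ ∨_) S y₂) → y₁ ≢ y₂ → y₁ ≤ κ′ y₂
      image-≤κ′ h₁ h₂ y₁≢y₂
        with j₁ , j₁∈S , refl ← image⁻ (j₀ ∨_) S h₁ | j₂ , j₂∈S , refl ← image⁻ (j₀ ∨_) S h₂ =
        subst (j₀ ∨ j₁ ≤_) (sym (proj₂ (lift (JI-members indep j₂∈S) (above _ j₂∈S))))
          (∨-least (above _ j₂∈S) (≤κ indep j₁∈S j₂∈S (λ { refl → y₁≢y₂ refl })))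

  image-⊆-reflect : ∀ {a b j₀ κ κ′ S₁ S₂} → IsPairing a b κ → IsPairing j₀ b κ′ → CondI a b j₀ →
    IsIndependent a b κ S₁ → AllAbove κ j₀ S₁ → IsIndependent a b κ S₂ → AllAbove κ j₀ S₂ →
    image (j₀ ∨_) S₁ ⊆ image (j₀ ∨_) S₂ → S₁ ⊆ S₂
  image-⊆-reflect {a} {b} {j₀} {κ} {S₁ = S₁} {S₂} isP isP′ condI ind₁ above₁ ind₂ above₂ image⊆ {j} j∈S₁
    with j′ , j′∈S₂ , j₀∨j′≡j₀∨j ← image⁻ (j₀ ∨_) S₂ (image⊆ (image⁺ (j₀ ∨_) S₁ j∈S₁)) =
    subst (T ∘ S₂) (lift-injective j′ j (JI-members ind₂ j′∈S₂) (above₂ _ j′∈S₂)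
                                        (JI-members ind₁ j∈S₁) (above₁ _ j∈S₁) j₀∨j′≡j₀∨j) j′∈S₂
    where
      lift-injective : ∀ j j′ → JI a b j → j₀ ≤ κ j → JI a b j′ → j₀ ≤ κ j′ → j₀ ∨ j ≡ j₀ ∨ j′ → j ≡ j′
      lift-injective = proj₁ (proj₂ (condI _ _ isP isP′))

  module _ {a b j₀ m₀ κ} (primePair : PrimePair a b j₀ m₀) (isP : IsPairing a b κ) where
    open PrimePairProperties primePair
    open PairingProperties isP

    -- For j₀ ≤ j, a witness s with j₀ ≰ κ s has κ s ≤ m₀; independence gives j ≤ κ s unless j = s,
    -- and j = s is impossible since j₀ < j forces j₀ ≤ κ j.
    independent-≤m₀ : ∀ {S} → IsIndependent a b κ S → ¬ AllAbove κ j₀ S → ∀ {j} → T (S j) → j ≢ j₀ → j ≤ m₀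
    independent-≤m₀ indep ¬above {j} j∈S j≢j₀ with ≤m₀⊎j₀≤ (JI⇒InI (JI-members indep j∈S))
    ... | inj₁ j≤m₀ = j≤m₀
    ... | inj₂ j₀≤j with ¬allAbove⇒witness ¬above
    ...   | s , s∈S , j₀≰κs with j ≟ s
    ...     | yes refl = contradiction (<⇒≤κ (JI-members indep j∈S) j₀∈ (j₀≤j , j≢j₀ ∘ sym)) j₀≰κs
    ...     | no  j≢s  = contradiction
      (≤-trans j₀≤j (≤-trans (≤κ indep j∈S s∈S j≢s) (j₀≰⇒≤m₀ (κ-InI (JI-members indep s∈S)) j₀≰κs))) j₀≰m₀

    remove-independent : ∀ {κ″ S} → IsPairing a m₀ κ″ → CondII a b m₀ →
      IsIndependent a b κ S → ¬ AllAbove κ j₀ S → IsIndependent a m₀ κ″ (remove j₀ S)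
    remove-independent {κ″} {S} isP″ condII indep ¬above = record
      { JI-members = λ h → proj₁ (restrict h)
      ; ≤κ         = λ h₁ h₂ j₁≢j₂ → subst (_ ≤_) (sym (proj₂ (restrict h₂)))
                       (∧-greatest (below h₁) (≤κ indep (proj₁ (remove⁻ j₀ S h₁)) (proj₁ (remove⁻ j₀ S h₂)) j₁≢j₂))
      }
      where
        below : ∀ {j} → T (remove j₀ S j) → j ≤ m₀
        below h = let j∈S , j≢j₀ = remove⁻ j₀ S h in independent-≤m₀ indep ¬above j∈S j≢j₀

        restrict : ∀ {j} → T (remove j₀ S j) → JI a m₀ j × κ″ j ≡ m₀ ∧ κ j
        restrict {j} h = let j-JI = JI-members indep (proj₁ (remove⁻ j₀ S h))
                             _ , j-JI″ , κ″j≡m₀∧κj = proj₁ (condII _ _ isP isP″) (κ j) j (κ-MI j-JI) j-JI refl (below h)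
                         in j-JI″ , κ″j≡m₀∧κj

  -- If j₀ ∈ S₁ but j₀ ∉ S₂, the witness s ≠ j₀ of S₂ would also lie in S₁, forcing j₀ ≤ κ s.
  remove-⊆-reflect : ∀ {a b κ j₀ S₁ S₂} → IsIndependent a b κ S₁ → ¬ AllAbove κ j₀ S₂ →
    remove j₀ S₁ ⊆ remove j₀ S₂ → remove j₀ S₂ ⊆ remove j₀ S₁ → S₁ ⊆ S₂
  remove-⊆-reflect {j₀ = j₀} {S₁} {S₂} ind₁ ¬above₂ remove⊆ remove⊇ {j} j∈S₁ with j ≟ j₀
  ... | no j≢j₀ = proj₁ (remove⁻ j₀ S₂ (remove⊆ (remove⁺ j₀ S₁ j∈S₁ j≢j₀)))
  ... | yes refl with ¬allAbove⇒witness ¬above₂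
  ...   | s , s∈S₂ , j₀≰κs with s ≟ j₀
  ...     | yes refl = s∈S₂
  ...     | no  s≢j₀ =
    contradiction (≤κ ind₁ j∈S₁ (proj₁ (remove⁻ j₀ S₁ (remove⊇ (remove⁺ j₀ S₂ s∈S₂ s≢j₀)))) (s≢j₀ ∘ sym)) j₀≰κs

  encode-injective : ∀ {a b κ S₁ S₂} (d : CD a b) → IsPairing a b κ →
    IsIndependent a b κ S₁ → IsIndependent a b κ S₂ → encode d κ S₁ ≡ encode d κ S₂ → S₁ ⊆ S₂
  encode-injective (cd-one _ refl) _ ind₁ _ _ j∈S₁ = contradiction (JI-members ind₁ j∈S₁) ¬JI[a,a]
  encode-injective {κ = κ} {S₁} {S₂} (cd-step j₀ m₀ _ pp cdT condI cdB condII) isP ind₁ ind₂ eq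
    with allAbove? κ j₀ S₁ | allAbove? κ j₀ S₂
  ... | yes above₁ | yes above₂ =
    let isPT = pairingOf-isPairing cdT in
    image-⊆-reflect isP isPT condI ind₁ above₁ ind₂ above₂
      (encode-injective cdT isPT (image-independent isP isPT condI ind₁ above₁)
                                 (image-independent isP isPT condI ind₂ above₂) eq)
  ... | yes _ | no _ = contradiction (subst (InI _ m₀) (sym eq) (encode-InI cdB _ _))
                         (PrimePairProperties.top∩bottom≡∅ pp (encode-InI cdT _ _))
  ... | no _ | yes _ = contradiction (subst (InI _ m₀) eq (encode-InI cdB _ _))
                         (PrimePairProperties.top∩bottom≡∅ pp (encode-InI cdT _ _))
  ... | no ¬above₁ | no ¬above₂ =
    let isPB = pairingOf-isPairing cdB
        rem₁ = remove-independent pp isP isPB condII ind₁ ¬above₁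
        rem₂ = remove-independent pp isP isPB condII ind₂ ¬above₂
    in remove-⊆-reflect ind₁ ¬above₂ (encode-injective cdB isPB rem₁ rem₂ eq)
                                     (encode-injective cdB isPB rem₂ rem₁ (sym eq))

  encode-≗ : ∀ {a b κ S₁ S₂} (d : CD a b) → IsPairing a b κ → IsIndependent a b κ S₁ → IsIndependent a b κ S₂ →
             encode d κ S₁ ≡ encode d κ S₂ → ∀ j → S₁ j ≡ S₂ j
  encode-≗ d isP ind₁ ind₂ eq j =
    T-injective (encode-injective d isP ind₁ ind₂ eq) (encode-injective d isP ind₂ ind₁ (sym eq))

  -- encode ∘ F is an injective endomap of Fin n, hence onto.
  injective⇒onto-independent : ∀ {a b κ} → CD a b → IsPairing a b κ → (F : Fin n → Subset) →
    (∀ x → IsIndependent a b κ (F x)) → (∀ {x y} → (∀ j → F x j ≡ F y j) → x ≡ y) →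
    ∀ {S} → IsIndependent a b κ S → ∃ λ r → ∀ j → F r j ≡ S j
  injective⇒onto-independent d isP F F-independent F-injective {S} S-independent =
    let r , eq = injective⇒strictlySurjective encode∘F-injective (encode d _ S) in
    r , encode-≗ d isP (F-independent r) S-independent eq
    where
      encode∘F-injective : Injective _≡_ _≡_ (λ x → encode d _ (F x))
      encode∘F-injective eq = F-injective (encode-≗ d isP (F-independent _) (F-independent _) eq)

module SemidistrimProperties {n : ℕ} (L : FinLattice n) (κ : Fin n → Fin n)
                             (semidistrim : Notions.Semidistrim L κ) where
  open LatticeProperties L public

  private
    isPairing : IsPairing ⊥ ⊤ κ
    isPairing = proj₁ semidistrim

    dismantling : CD ⊥ ⊤
    dismantling = proj₁ (proj₂ semidistrim)

  open PairingProperties isPairing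

  label : ∀ {x y} → x ⋖ y → CoverLabel ⊥ ⊤ κ x y
  label = coverLabel dismantling isPairing (InI-whole _) (InI-whole _)

  Dset⁺ : ∀ {x y j} → JIL j → y ⋖ x → j ≤ x → y ≤ κ j → T (Dset κ x j)
  Dset⁺ {x} {y} {j} j-JI y⋖x j≤x y≤κj =
    &&⁺ {JIᵇ ⊥ ⊤ j} j-JI (any-elems⁺ y (&&⁺ {y ⋖ᵇ x} y⋖x (&&⁺ {j ≤ᵇ x} (fromWitness j≤x) (fromWitness y≤κj))))

  Dset⁻ : ∀ {x j} → T (Dset κ x j) → JIL j × ∃ λ y → y ⋖ x × j ≤ x × y ≤ κ j
  Dset⁻ {x} {j} h =
    let j-JI , p = &&⁻ {JIᵇ ⊥ ⊤ j} h
        y , q = any-elems⁻ p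
        y⋖x , r = &&⁻ {y ⋖ᵇ x} q
        j≤x , y≤κj = &&⁻ {j ≤ᵇ x} r
    in j-JI , y , y⋖x , toWitness j≤x , toWitness y≤κj

  Uset⁺ : ∀ {x y j} → JIL j → x ⋖ y → j ≤ y → x ≤ κ j → T (Uset κ x j)
  Uset⁺ {x} {y} {j} j-JI x⋖y j≤y x≤κj =
    &&⁺ {JIᵇ ⊥ ⊤ j} j-JI (any-elems⁺ y (&&⁺ {x ⋖ᵇ y} x⋖y (&&⁺ {j ≤ᵇ y} (fromWitness j≤y) (fromWitness x≤κj))))

  Uset⁻ : ∀ {x j} → T (Uset κ x j) → JIL j × ∃ λ y → x ⋖ y × j ≤ y × x ≤ κ j
  Uset⁻ {x} {j} h =
    let j-JI , p = &&⁻ {JIᵇ ⊥ ⊤ j} h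
        y , q = any-elems⁻ p
        x⋖y , r = &&⁻ {x ⋖ᵇ y} q
        j≤y , x≤κj = &&⁻ {j ≤ᵇ y} r
    in j-JI , y , x⋖y , toWitness j≤y , toWitness x≤κj

  -- The label j of a cover x ⋖ y ≤ ⋀ κ(U x) would lie in U x, giving j ≤ y ≤ κ j.
  x≡⋀κUx : ∀ x → x ≡ ⋀[ Uset κ x ] κ
  x≡⋀κUx x = [ id , (λ x<⋀ → contradiction x<⋀ x≮⋀) ]′
                (≤⇒≡⊎< (⋀-greatest (λ _ h → proj₂ (proj₂ (proj₂ (proj₂ (Uset⁻ h)))))))
    where
      x≮⋀ : ¬ x < ⋀[ Uset κ x ] κ
      x≮⋀ x<⋀ = let y , x⋖y , y≤⋀ = cover-above x<⋀
                    j , j-JI , j≤y , x≤κj = label x⋖y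
                in j≰κj j-JI (≤-trans j≤y (≤-trans y≤⋀ (⋀-lowerBound (Uset⁺ j-JI x⋖y j≤y x≤κj))))

  x≡⋁Dx : ∀ x → x ≡ ⋁[ Dset κ x ] id
  x≡⋁Dx x = [ sym , (λ ⋁<x → contradiction ⋁<x ⋁≮x) ]′
               (≤⇒≡⊎< (⋁-least (λ _ h → proj₁ (proj₂ (proj₂ (proj₂ (Dset⁻ h)))))))
    where
      ⋁≮x : ¬ ⋁[ Dset κ x ] id < x
      ⋁≮x ⋁<x = let y , ⋁≤y , y⋖x = cover-below ⋁<x
                    j , j-JI , j≤x , y≤κj = label y⋖x
                in j≰κj j-JI (≤-trans (⋁-upperBound (Dset⁺ j-JI y⋖x j≤x y≤κj)) (≤-trans ⋁≤y y≤κj))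

  Pop↓≡x∧⋀κDx : ∀ x → Pop↓ x ≡ x ∧ ⋀[ Dset κ x ] κ
  Pop↓≡x∧⋀κDx x = antisym
    (∧-greatest (x∧y≤x _ _) (⋀-greatest λ j j∈D →
       let _ , y , y⋖x , _ , y≤κj = Dset⁻ j∈D in
       ≤-trans (x∧y≤y _ _) (≤-trans (⋀-lowerBound {λ y → y ⋖ᵇ x} y⋖x) y≤κj)))
    (∧-greatest (x∧y≤x _ _) (⋀-greatest λ y y⋖x →
       let j , j-JI , j≤x , y≤κj = label y⋖x in
       subst (_ ≤_) (⋖⇒∧κ≡ y⋖x j-JI j≤x y≤κj)
         (∧-greatest (x∧y≤x _ _) (≤-trans (x∧y≤y _ _) (⋀-lowerBound (Dset⁺ j-JI y⋖x j≤x y≤κj))))))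

  Pop↑≡x∨⋁Ux : ∀ x → Pop↑ x ≡ x ∨ ⋁[ Uset κ x ] id
  Pop↑≡x∨⋁Ux x = antisym
    (∨-least (x≤x∨y _ _) (⋁-least λ y x⋖y →
       let j , j-JI , j≤y , x≤κj = label x⋖y in
       subst (_≤ _) (⋖⇒∨≡ x⋖y j-JI j≤y x≤κj)
         (∨-least (x≤x∨y _ _) (≤-trans (⋁-upperBound (Uset⁺ j-JI x⋖y j≤y x≤κj)) (y≤x∨y _ _)))))
    (∨-least (x≤x∨y _ _) (⋁-least λ j j∈U →
       let _ , y , x⋖y , j≤y , _ = Uset⁻ j∈U in
       ≤-trans j≤y (≤-trans (⋁-upperBound {λ y → x ⋖ᵇ y} x⋖y) (y≤x∨y _ _))))

  Independent⇒IsIndependent : ∀ {S} → Independent κ S → (∀ {j} → T (S j) → JIL j) → IsIndependent ⊥ ⊤ κ S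
  Independent⇒IsIndependent noEdge members-JI = record
    { JI-members = members-JI
    ; ≤κ         = λ j∈S j′∈S j≢j′ →
                     decidable-stable (_ ≤? _) (λ j≰κj′ → noEdge _ _ j∈S j′∈S (j≢j′ , j≰κj′))
    }

  D-independent : ∀ x → IsIndependent ⊥ ⊤ κ (Dset κ x)
  D-independent x = Independent⇒IsIndependent (proj₁ (proj₂ (proj₂ semidistrim) x)) (proj₁ ∘ Dset⁻)

  U-independent : ∀ x → IsIndependent ⊥ ⊤ κ (Uset κ x)
  U-independent x = Independent⇒IsIndependent (proj₂ (proj₂ (proj₂ semidistrim) x)) (proj₁ ∘ Uset⁻)

  RowOf⇒≡⋀κD : ∀ {x y} → RowOf κ x y → y ≡ ⋀[ Dset κ x ] κ
  RowOf⇒≡⋀κD {y = y} U≗D = trans (x≡⋀κUx y) (⋀-cong U≗D)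

  RowOf⇒≡⋁U : ∀ {x y} → RowOf κ y x → y ≡ ⋁[ Uset κ x ] id
  RowOf⇒≡⋁U {y = y} U≗D = trans (x≡⋁Dx y) (⋁-cong (sym ∘ U≗D))

  Uset-injective : ∀ {x y} → (∀ j → Uset κ x j ≡ Uset κ y j) → x ≡ y
  Uset-injective {x} {y} U≗ = trans (x≡⋀κUx x) (trans (⋀-cong U≗) (sym (x≡⋀κUx y)))

  Dset-injective : ∀ {x y} → (∀ j → Dset κ x j ≡ Dset κ y j) → x ≡ y
  Dset-injective {x} {y} D≗ = trans (x≡⋁Dx x) (trans (⋁-cong D≗) (sym (x≡⋁Dx y)))

  RowOf-⋀κD : ∀ x → RowOf κ x (⋀[ Dset κ x ] κ)
  RowOf-⋀κD x =
    let _ , U≗D = injective⇒onto-independent dismantling isPairing (Uset κ) U-independent Uset-injective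
                    (D-independent x)
    in subst (RowOf κ x) (RowOf⇒≡⋀κD U≗D) U≗D

  RowOf-⋁U : ∀ x → RowOf κ (⋁[ Uset κ x ] id) x
  RowOf-⋁U x =
    let _ , D≗U = injective⇒onto-independent dismantling isPairing (Dset κ) D-independent Dset-injective
                    (U-independent x)
    in subst (λ w → RowOf κ w x) (RowOf⇒≡⋁U (sym ∘ D≗U)) (sym ∘ D≗U)

theorem9p1 : ∀ {n : ℕ} (L : FinLattice n) (κ : Fin n → Fin n) →
    let open Notions L in
    Semidistrim κ → (x : Fin n) →
    (RowOf κ x (⋀[ Dset κ x ] κ) × (∀ y → RowOf κ x y → y ≡ ⋀[ Dset κ x ] κ))
    × (RowOf κ (⋁[ Uset κ x ] (λ j → j)) x × (∀ y → RowOf κ y x → y ≡ ⋁[ Uset κ x ] (λ j → j)))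
    × Pop↓ x ≡ x ∧ (⋀[ Dset κ x ] κ)
    × Pop↑ x ≡ x ∨ (⋁[ Uset κ x ] (λ j → j))
    × (∀ r → RowOf κ x r → Pop↓ x ≡ x ∧ r)
    × (∀ r → RowOf κ r x → Pop↑ x ≡ x ∨ r)
theorem9p1 L κ semidistrim x =
  (RowOf-⋀κD x , λ _ → RowOf⇒≡⋀κD) ,
  (RowOf-⋁U x , λ _ → RowOf⇒≡⋁U) ,
  Pop↓≡x∧⋀κDx x ,
  Pop↑≡x∨⋁Ux x ,
  (λ _ row → trans (Pop↓≡x∧⋀κDx x) (cong (x ∧_) (sym (RowOf⇒≡⋀κD row)))) ,
  (λ _ row → trans (Pop↑≡x∨⋁Ux x) (cong (x ∨_) (sym (RowOf⇒≡⋁U row))))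
  where open SemidistrimProperties L κ semidistrim
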